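{- Let $m,n$ be integers with $mn<0$. There is no positive integral $SL_2$-tiling $(u_{i,j})_{i,j\in\mathbb Z}$ such that $u_{i,j}=u_{i+m,j+n}$ for all $i,j\in\mathbb Z$.
   Context: An $SL_2$-tiling is a family $(u_{i,j})_{i,j\in\mathbb Z}$ of real numbers such that $u_{i+1,j}u_{i,j+1}-u_{i,j}u_{i+1,j+1}=1$ for all $i,j$ (all adjacent $2\times2$ minors equal $1$ when the row index $i$ increases from bottom to top and the column index $j$ from left to right). It is positive integral if all $u_{i,j}$ are positive integers. -}

module Defs where

open import Data.Integer using (ℤ; +_; _+_; _*_; _-_; _<_; 0ℤ; 1ℤ)
open import Data.Nat using (ℕ)
import Data.Nat as ℕ
open import Relation.Binary.PropositionalEquality using (_≡_)
open import Data.Product using (_×_)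

IsSL2Tiling : (ℤ → ℤ → ℤ) → Set
IsSL2Tiling u = ∀ i j →
  u (i + 1ℤ) j * u i (j + 1ℤ) - u i j * u (i + 1ℤ) (j + 1ℤ) ≡ 1ℤ

IsPositiveIntegralSL2Tiling : (ℤ → ℤ → ℤ) → Set
IsPositiveIntegralSL2Tiling u = IsSL2Tiling u × (∀ i j → 0ℤ < u i j)

IsPeriodic : ℤ → ℤ → (ℤ → ℤ → ℤ) → Set
IsPeriodic m n u = ∀ i j → u i j ≡ u (i + m) (j + n)

-- In a positive SL₂-tiling every minor u(i+p,j) u(i,j+q) − u(i,j) u(i+p,j+q)
-- with p, q > 0 is positive: the unit minors equal 1, and positivity survives
-- gluing two rectangles along a common edge, since it says that a ratio of
-- entries grows across the rectangle.  For a period (M, −K) with M, K > 0,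
-- periodicity carries the right-hand corners of the M × K rectangle at (tM, 0)
-- back to column 0, so s t = u (tM) 0 satisfies s t · s (t+2) < s (t+1)².
-- A positive integer sequence on ℤ with this property is strictly increasing,
-- since once it stops increasing it decreases forever; but so is its
-- reflection t ↦ s (−t), which is absurd.
{-# OPTIONS --safe #-}
module Submission where

open import Defs
open import Data.Integer
  using (ℤ; _*_; _<_; 0ℤ; +_; -[1+_]; _+_; _-_; -_; _≤_; 1ℤ; -1ℤ; ∣_∣; +<+; +≤+)
  renaming (suc to sucℤ)
open import Relation.Nullary using (¬_)
open import Data.Product using (Σ; _×_; _,_)
open import Data.Integer.Base using (positive; nonNegative)
open import Data.Integer.Properties
open import Algebra.Properties.CommutativeSemigroup *-commutativeSemigroup
  using (xy∙z≈xz∙y; x∙yz≈xz∙y)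
open import Algebra.Properties.AbelianGroup +-0-abelianGroup using (//-rightDividesˡ)
open import Data.Integer.Tactic.RingSolver using (solve-∀)
open import Data.Nat using (ℕ; zero; suc; z≤n)
import Data.Nat as ℕ
open import Function using (_∘_)
open import Relation.Binary.PropositionalEquality

i-j≡1⇒j<i : ∀ {i j} → i - j ≡ 1ℤ → j < i
i-j≡1⇒j<i {i} {j} i-j≡1 = suc[i]≤j⇒i<j (≤-reflexive (begin
  1ℤ + j     ≡⟨ cong (_+ j) i-j≡1 ⟨
  i - j + j  ≡⟨ //-rightDividesˡ j i ⟩
  i          ∎))
  where open ≡-Reasoning

-- Transitivity of a/b < c/d < e/f, cleared of the denominators.
*-cross-<-trans : ∀ {a b c d e f} → 0ℤ < b → 0ℤ < d → 0ℤ < f →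
                  a * d < b * c → c * f < d * e → a * f < b * e
*-cross-<-trans {a} {b} {c} {d} {e} {f} 0<b 0<d 0<f ad<bc cf<de =
  *-cancelʳ-<-nonNeg d {{nonNegative (<⇒≤ 0<d)}} (begin-strict
    a * f * d    ≡⟨ xy∙z≈xz∙y a f d ⟩
    a * d * f    <⟨ *-monoʳ-<-pos f {{positive 0<f}} ad<bc ⟩
    b * c * f    ≡⟨ *-assoc b c f ⟩
    b * (c * f)  <⟨ *-monoˡ-<-pos b {{positive 0<b}} cf<de ⟩
    b * (d * e)  ≡⟨ x∙yz≈xz∙y b d e ⟩
    b * e * d    ∎)
  where open ≤-Reasoning

StrictlyLogConcave : (ℤ → ℤ) → Set
StrictlyLogConcave s = ∀ t → s t * s (sucℤ (sucℤ t)) < s (sucℤ t) * s (sucℤ t)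

strictlyLogConcave-reflect : ∀ {s} → StrictlyLogConcave s → StrictlyLogConcave (s ∘ -_)
strictlyLogConcave-reflect {s} slc t =
  subst₂ (λ x y → s x * s t′ < s y * s y) (index₂ t) (index₁ t)
    (subst (_< s (sucℤ t′) * s (sucℤ t′)) (*-comm (s t′) (s (sucℤ (sucℤ t′)))) (slc t′))
  where
  t′ : ℤ
  t′ = - sucℤ (sucℤ t)
  index₂ : ∀ t → 1ℤ + (1ℤ + - (1ℤ + (1ℤ + t))) ≡ - t
  index₂ = solve-∀
  index₁ : ∀ t → 1ℤ + - (1ℤ + (1ℤ + t)) ≡ - (1ℤ + t)
  index₁ = solve-∀

module _ {s : ℤ → ℤ} (s-pos : ∀ t → 0ℤ < s t) (slc : StrictlyLogConcave s) where

  private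
    nonIncreasing⇒decreasing : ∀ {t} → s (sucℤ t) ≤ s t → s (sucℤ (sucℤ t)) < s (sucℤ t)
    nonIncreasing⇒decreasing {t} s₁≤s₀ =
      *-cancelˡ-<-nonNeg (s t) {{nonNegative (<⇒≤ (s-pos t))}} (begin-strict
        s t * s (sucℤ (sucℤ t))   <⟨ slc t ⟩
        s (sucℤ t) * s (sucℤ t)   ≤⟨ *-monoʳ-≤-nonNeg (s (sucℤ t)) {{nonNegative (<⇒≤ (s-pos _))}} s₁≤s₀ ⟩
        s t * s (sucℤ t)          ∎)
      where open ≤-Reasoning

    nonIncreasing⇒unbounded : ∀ k {t} → s (sucℤ t) ≤ s t → + k < s (sucℤ t)
    nonIncreasing⇒unbounded zero    _     = s-pos _
    nonIncreasing⇒unbounded (suc k) {t} s₁≤s₀ =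
      ≤-<-trans (i<j⇒suc[i]≤j (nonIncreasing⇒unbounded k (<⇒≤ s₂<s₁))) s₂<s₁
      where
      s₂<s₁ : s (sucℤ (sucℤ t)) < s (sucℤ t)
      s₂<s₁ = nonIncreasing⇒decreasing s₁≤s₀

  strictlyLogConcave⇒increasing : ∀ t → s t < s (sucℤ t)
  strictlyLogConcave⇒increasing t = ≰⇒> λ s₁≤s₀ →
    <-irrefl (0≤i⇒+∣i∣≡i (<⇒≤ (s-pos _))) (nonIncreasing⇒unbounded ∣ s (sucℤ t) ∣ s₁≤s₀)

¬positive-strictlyLogConcave : ∀ {s} → (∀ t → 0ℤ < s t) → ¬ StrictlyLogConcave s
¬positive-strictlyLogConcave {s} s-pos slc =
  <-asym (strictlyLogConcave⇒increasing s-pos slc -1ℤ)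
         (strictlyLogConcave⇒increasing {s ∘ -_} (s-pos ∘ -_) (strictlyLogConcave-reflect {s} slc) 0ℤ)

PositiveMinor : (ℤ → ℤ → ℤ) → ℤ → ℤ → ℕ → ℕ → Set
PositiveMinor u i j p q = u i j * u (i + + p) (j + + q) < u (i + + p) j * u i (j + + q)

isPeriodic-neg : ∀ {m n u} → IsPeriodic m n u → IsPeriodic (- m) (- n) u
isPeriodic-neg {m} {n} {u} per i j =
  sym (trans (per (i - m) (j - n)) (cong₂ u (//-rightDividesˡ m i) (//-rightDividesˡ n j)))

module PositiveSL2Tiling {u} (tiling : IsSL2Tiling u) (u-pos : ∀ i j → 0ℤ < u i j) where

  positiveMinor-unit : ∀ i j → PositiveMinor u i j 1 1
  positiveMinor-unit i j = i-j≡1⇒j<i (tiling i j)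

  positiveMinor-glueⱼ : ∀ {i j p q q′} → PositiveMinor u i j p q →
                        PositiveMinor u i (j + + q) p q′ → PositiveMinor u i j p (q ℕ.+ q′)
  positiveMinor-glueⱼ {i} {j} {p} {q} {q′} left right
    rewrite sym (+-assoc j (+ q) (+ q′)) =
    *-cross-<-trans {a = u i j} {c = C} {e = F} (u-pos _ _) (u-pos _ _) (u-pos _ _) left right
    where
    C F : ℤ
    C = u i (j + + q)
    F = u i (j + + q + + q′)

  positiveMinor-glueᵢ : ∀ {i j p p′ q} → PositiveMinor u i j p q →
                        PositiveMinor u (i + + p) j p′ q → PositiveMinor u i j (p ℕ.+ p′) q
  positiveMinor-glueᵢ {i} {j} {p} {p′} {q} below above
    rewrite sym (+-assoc i (+ p) (+ p′)) =
    swapʳ C F (*-cross-<-trans {a = u i j} {c = B} {e = F} (u-pos _ _) (u-pos _ _) (u-pos _ _)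
                (swapʳ B C below) (swapʳ F D above))
    where
    B C D F : ℤ
    B = u (i + + p) j
    C = u i (j + + q)
    D = u (i + + p) (j + + q)
    F = u (i + + p + + p′) j
    swapʳ : ∀ {a} b c → a < b * c → a < c * b
    swapʳ {a} b c = subst (a <_) (*-comm b c)

  positiveMinor-row : ∀ i j q → PositiveMinor u i j 1 (suc q)
  positiveMinor-row i j zero    = positiveMinor-unit i j
  positiveMinor-row i j (suc q) =
    positiveMinor-glueⱼ (positiveMinor-unit i j) (positiveMinor-row i (j + 1ℤ) q)

  positiveMinor : ∀ i j p q → PositiveMinor u i j (suc p) (suc q)
  positiveMinor i j zero    q = positiveMinor-row i j q
  positiveMinor i j (suc p) q =
    positiveMinor-glueᵢ (positiveMinor-row i j q) (positiveMinor (i + 1ℤ) j p q)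

  module _ {p q} (per : IsPeriodic (+ suc p) -[1+ q ] u) where

    private
      M K : ℤ
      M = + suc p
      K = + suc q

      shift : ∀ i → u i K ≡ u (i + M) 0ℤ
      shift i = trans (per i K) (cong (u (i + M)) (+-inverseʳ K))

      next-multiple : ∀ t → sucℤ t * M ≡ t * M + M
      next-multiple t = trans (suc-* t M) (+-comm M (t * M))

    column-strictlyLogConcave : ∀ i → u i 0ℤ * u (i + M + M) 0ℤ < u (i + M) 0ℤ * u (i + M) 0ℤ
    column-strictlyLogConcave i =
      subst₂ (λ x y → u i 0ℤ * x < u (i + M) 0ℤ * y) (shift (i + M)) (shift i) (positiveMinor i 0ℤ p q)

    periodic⇒strictlyLogConcave : StrictlyLogConcave (λ t → u (t * M) 0ℤ)
    periodic⇒strictlyLogConcave t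
      rewrite next-multiple (sucℤ t) | next-multiple t = column-strictlyLogConcave (t * M)

  ¬periodic : ∀ p q → ¬ IsPeriodic (+ suc p) -[1+ q ] u
  ¬periodic p q per = ¬positive-strictlyLogConcave (λ _ → u-pos _ _) (periodic⇒strictlyLogConcave per)

proposition5p2 : (m n : ℤ) → m * n < 0ℤ →
    ¬ (Σ (ℤ → ℤ → ℤ) λ u → IsPositiveIntegralSL2Tiling u × IsPeriodic m n u)
proposition5p2 (+ zero)   n          0<0  _ = <-irrefl refl 0<0
proposition5p2 (+ suc p)  (+ n)      mn<0 _ = <⇒≱ mn<0 (subst (0ℤ ≤_) (pos-* (suc p) n) (+≤+ z≤n))
proposition5p2 (+ suc p)  -[1+ q ]   _    (u , (tiling , u-pos) , per) =
  PositiveSL2Tiling.¬periodic tiling u-pos p q per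
proposition5p2 -[1+ p ]   (+ zero)   mn<0 _ = <-irrefl (*-zeroʳ -[1+ p ]) mn<0
proposition5p2 -[1+ p ]   (+ suc q)  _    (u , (tiling , u-pos) , per) =
  PositiveSL2Tiling.¬periodic tiling u-pos p q (isPeriodic-neg per)
proposition5p2 -[1+ p ]   -[1+ q ]   (+<+ ()) _
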